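{- For all integers $n,C,\Delta\ge1$, $$A(n,C,\Delta)\le \left\lceil\frac{n\Delta}{2C}\right\rceil n.$$
   Context: Consider a ring with node set $V(C_n)$ of $n$ nodes. A request graph is a simple graph $R$ whose vertices are nodes of the ring. Given integers $n,C,\Delta\ge1$, an assignment of nonnegative integers $A(v)$, $v\in V(C_n)$, is feasible if for every request graph $R$ of maximum degree at most $\Delta$ there exists a partition of $E(R)$ into subgraphs $B_1,\dots,B_\Lambda$ such that $|E(B_\lambda)|\le C$ for all $\lambda$ and every vertex $v$ appears in at most $A(v)$ of the subgraphs $B_\lambda$. $A(n,C,\Delta)$ denotes the minimum of $\sum_{v}A(v)$ over all feasible assignments. -}

module Defs where

open import Data.Nat using (ℕ; zero; suc; _+_; _*_; _≤_; _<ᵇ_)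
open import Data.Nat.DivMod using (_/_)
open import Data.Fin using (Fin; zero; suc; toℕ; _≟_)
open import Data.Bool using (Bool; true; false; if_then_else_; _∧_; _∨_)
open import Data.Product using (Σ; _×_)
open import Relation.Nullary.Decidable using (⌊_⌋)
open import Relation.Binary.PropositionalEquality using (_≡_)

count : ∀ {k} → (Fin k → Bool) → ℕ
count {zero}  p = 0
count {suc k} p = (if p zero then 1 else 0) + count (λ i → p (suc i))

sumFin : ∀ {k} → (Fin k → ℕ) → ℕ
sumFin {zero}  f = 0
sumFin {suc k} f = f zero + sumFin (λ i → f (suc i))

-- ceiling of m / d (for d ≥ 1); defined as 0 when d = 0
ceilDiv : ℕ → ℕ → ℕ
ceilDiv m zero    = 0
ceilDiv m (suc d) = (m + d) / suc d

record SimpleGraph (n : ℕ) : Set where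
  field
    adj    : Fin n → Fin n → Bool
    sym    : ∀ u v → adj u v ≡ adj v u
    irrefl : ∀ v → adj v v ≡ false
open SimpleGraph public

degree : ∀ {n} → SimpleGraph n → Fin n → ℕ
degree R v = count (adj R v)

MaxDegree≤ : ∀ {n} → SimpleGraph n → ℕ → Set
MaxDegree≤ R Δ = ∀ v → degree R v ≤ Δ

-- the edge {u,v} of R, represented by the ordered pair with u < v
isEdge : ∀ {n} → SimpleGraph n → Fin n → Fin n → Bool
isEdge R u v = adj R u v ∧ (toℕ u <ᵇ toℕ v)

-- A partition of E(R) into Λ subgraphs B_0..B_{Λ-1} is given by a labelling
-- c : the edge {u,v} (u < v) lies in B_(c u v). (Values of c on non-edges are irrelevant.)
Labelling : ℕ → ℕ → Set
Labelling n Λ = Fin n → Fin n → Fin Λ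

inClass : ∀ {n Λ} → SimpleGraph n → Labelling n Λ → Fin Λ → Fin n → Fin n → Bool
inClass R c l u v = isEdge R u v ∧ ⌊ c u v ≟ l ⌋

classSize : ∀ {n Λ} → SimpleGraph n → Labelling n Λ → Fin Λ → ℕ
classSize R c l = sumFin (λ u → count (λ v → inClass R c l u v))

appearsIn : ∀ {n Λ} → SimpleGraph n → Labelling n Λ → Fin n → Fin Λ → Bool
appearsIn {n} R c v l with count (λ u → inClass R c l u v ∨ inClass R c l v u)
... | zero  = false
... | suc _ = true

appearances : ∀ {n Λ} → SimpleGraph n → Labelling n Λ → Fin n → ℕ
appearances R c v = count (appearsIn R c v)

Feasible : (n C Δ : ℕ) → (Fin n → ℕ) → Set
Feasible n C Δ A =
  (R : SimpleGraph n) → MaxDegree≤ R Δ →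
  Σ ℕ λ Λ → Σ (Labelling n Λ) λ c →
    ((l : Fin Λ) → classSize R c l ≤ C) × ((v : Fin n) → appearances R c v ≤ A v)

-- Give every node the same budget K = ⌈nΔ/2C⌉. By the handshake lemma R has at most
-- nΔ/2 ≤ KC edges; number them 0, 1, 2, … in row-major order and put edge number i into
-- class ⌊i/C⌋. Each class is a block of at most C consecutive numbers, there are at most
-- K classes, so every node appears in at most K of them, for a total of Kn.
module Submission where

open import Defs hiding (sym)
open import Data.Nat using (ℕ; zero; suc; _+_; _*_; _∸_; _≤_; _<_; _<ᵇ_; z≤n; s≤s; s≤s⁻¹; NonZero)
open import Data.Nat.Properties
  using (+-assoc; +-comm; +-suc; +-identityʳ; *-comm; *-zeroʳ; +-commutativeSemigroup; *-commutativeSemigroup;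
         ≤-trans; ≤-reflexive; n≤1+n; m≤m+n; +-mono-≤; +-monoʳ-≤; +-monoˡ-≤; +-monoˡ-<; *-mono-≤;
         *-cancelˡ-≤; +-cancelʳ-≤; module ≤-Reasoning; ∸-monoˡ-≤; ∸-monoʳ-≤; +-∸-assoc; 0∸n≡0; m<n+o⇒m∸n<o)
open import Data.Nat.DivMod using (_/_; _%_; _mod_; m≡m%n+[m/n]*n; m%n<n; m/n*n≤m; m<n*o⇒m/o<n; m<n⇒m%n≡m)
open import Data.Fin using (Fin; zero; suc; toℕ; _≟_)
open import Data.Fin.Properties using (toℕ-injective; toℕ-fromℕ<)
open import Data.Bool using (Bool; true; false; if_then_else_; _∧_)
open import Data.Product using (Σ; _×_; _,_)
open import Data.Empty using (⊥-elim)
open import Function using (_∘_)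
open import Relation.Nullary using (yes)
open import Relation.Nullary.Decidable using (⌊_⌋)
open import Relation.Binary.PropositionalEquality
  using (_≡_; _≢_; refl; sym; trans; cong; cong₂; subst; module ≡-Reasoning)
open import Algebra.Properties.CommutativeSemigroup +-commutativeSemigroup using (interchange)
open import Algebra.Properties.CommutativeSemigroup *-commutativeSemigroup using (x∙yz≈y∙xz)

[_] : Bool → ℕ
[ b ] = if b then 1 else 0

count-cong : ∀ {k} {p q : Fin k → Bool} → (∀ i → p i ≡ q i) → count p ≡ count q
count-cong {zero}  e = refl
count-cong {suc k} e = cong₂ _+_ (cong [_] (e zero)) (count-cong (e ∘ suc))

count≤ : ∀ {k} (p : Fin k → Bool) → count p ≤ k
count≤ {zero}  p = z≤n
count≤ {suc k} p with p zero
... | true  = s≤s (count≤ (p ∘ suc))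
... | false = ≤-trans (count≤ (p ∘ suc)) (n≤1+n k)

count≡sumFin : ∀ {k} (p : Fin k → Bool) → count p ≡ sumFin (λ i → [ p i ])
count≡sumFin {zero}  p = refl
count≡sumFin {suc k} p = cong ([ p zero ] +_) (count≡sumFin (p ∘ suc))

sumFin-cong : ∀ {k} {f g : Fin k → ℕ} → (∀ i → f i ≡ g i) → sumFin f ≡ sumFin g
sumFin-cong {zero}  e = refl
sumFin-cong {suc k} e = cong₂ _+_ (e zero) (sumFin-cong (e ∘ suc))

sumFin-+ : ∀ {k} (f g : Fin k → ℕ) → sumFin (λ i → f i + g i) ≡ sumFin f + sumFin g
sumFin-+ {zero}  f g = refl
sumFin-+ {suc k} f g = trans (cong (f zero + g zero +_) (sumFin-+ (f ∘ suc) (g ∘ suc)))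
                             (interchange (f zero) (g zero) (sumFin (f ∘ suc)) (sumFin (g ∘ suc)))

sumFin-const : ∀ k d → sumFin {k} (λ _ → d) ≡ k * d
sumFin-const zero    d = refl
sumFin-const (suc k) d = cong (d +_) (sumFin-const k d)

sumFin-≤ : ∀ {k} (f : Fin k → ℕ) {d} → (∀ i → f i ≤ d) → sumFin f ≤ k * d
sumFin-≤ {zero}  f h = z≤n
sumFin-≤ {suc k} f h = +-mono-≤ (h zero) (sumFin-≤ (f ∘ suc) (h ∘ suc))

sumFin-swap : ∀ {m k} (f : Fin m → Fin k → ℕ) →
  sumFin (λ u → sumFin (f u)) ≡ sumFin (λ v → sumFin (λ u → f u v))
sumFin-swap {zero} {k} f = sym (trans (sumFin-const k 0) (*-zeroʳ k))
sumFin-swap {suc m} f = trans (cong (sumFin (f zero) +_) (sumFin-swap (f ∘ suc)))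
                              (sym (sumFin-+ (f zero) (λ v → sumFin (λ u → f (suc u) v))))

<ᵇ-exclusive : ∀ x y → x ≢ y → [ x <ᵇ y ] + [ y <ᵇ x ] ≡ 1
<ᵇ-exclusive zero    zero    x≢y = ⊥-elim (x≢y refl)
<ᵇ-exclusive zero    (suc y) x≢y = refl
<ᵇ-exclusive (suc x) zero    x≢y = refl
<ᵇ-exclusive (suc x) (suc y) x≢y = <ᵇ-exclusive x y (x≢y ∘ cong suc)

edgeCount : ∀ {n} → SimpleGraph n → ℕ
edgeCount R = sumFin (λ u → count (isEdge R u))

adj-split : ∀ {n} (R : SimpleGraph n) u v → [ adj R u v ] ≡ [ isEdge R u v ] + [ isEdge R v u ]
adj-split R u v rewrite SimpleGraph.sym R v u with adj R u v in uv
... | false = refl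
... | true  = sym (<ᵇ-exclusive (toℕ u) (toℕ v) u≢v)
  where
  u≢v : toℕ u ≢ toℕ v
  u≢v u≡v with () ← trans (sym uv) (subst (λ w → adj R u w ≡ false) (toℕ-injective u≡v) (irrefl R u))

handshake : ∀ {n} (R : SimpleGraph n) → sumFin (degree R) ≡ edgeCount R + edgeCount R
handshake R = begin
  sumFin (λ u → count (adj R u))
    ≡⟨ sumFin-cong (λ u → count≡sumFin (adj R u)) ⟩
  sumFin (λ u → sumFin (λ v → [ adj R u v ]))
    ≡⟨ sumFin-cong (λ u → sumFin-cong (adj-split R u)) ⟩
  sumFin (λ u → sumFin (λ v → [ isEdge R u v ] + [ isEdge R v u ]))
    ≡⟨ sumFin-cong (λ u → sumFin-+ (λ v → [ isEdge R u v ]) (λ v → [ isEdge R v u ])) ⟩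
  sumFin (λ u → sumFin (λ v → [ isEdge R u v ]) + sumFin (λ v → [ isEdge R v u ]))
    ≡⟨ sumFin-+ (λ u → sumFin (λ v → [ isEdge R u v ])) (λ u → sumFin (λ v → [ isEdge R v u ])) ⟩
  sumFin (λ u → sumFin (λ v → [ isEdge R u v ])) + sumFin (λ u → sumFin (λ v → [ isEdge R v u ]))
    ≡⟨ cong (sumFin (λ u → sumFin (λ v → [ isEdge R u v ])) +_) (sumFin-swap (λ u v → [ isEdge R v u ])) ⟩
  sumFin (λ u → sumFin (λ v → [ isEdge R u v ])) + sumFin (λ v → sumFin (λ u → [ isEdge R v u ]))
    ≡⟨ cong₂ _+_ edges edges ⟩
  edgeCount R + edgeCount R ∎
  where
  open ≡-Reasoning
  edges : sumFin (λ u → sumFin (λ v → [ isEdge R u v ])) ≡ edgeCount R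
  edges = sym (sumFin-cong (λ u → count≡sumFin (isEdge R u)))

edgeCount≤ : ∀ {n Δ} (R : SimpleGraph n) → MaxDegree≤ R Δ → 2 * edgeCount R ≤ n * Δ
edgeCount≤ {n} {Δ} R maxdeg = begin
  2 * edgeCount R                ≡⟨ cong (edgeCount R +_) (+-identityʳ (edgeCount R)) ⟩
  edgeCount R + edgeCount R      ≡⟨ sym (handshake R) ⟩
  sumFin (degree R)              ≤⟨ sumFin-≤ (degree R) maxdeg ⟩
  n * Δ                          ∎
  where open ≤-Reasoning

countRange : (ℕ → Bool) → ℕ → ℕ → ℕ
countRange Q s zero    = 0
countRange Q s (suc t) = [ Q s ] + countRange Q (suc s) t

countRange-+ : ∀ Q s a b → countRange Q s (a + b) ≡ countRange Q s a + countRange Q (s + a) b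
countRange-+ Q s zero    b = cong (λ x → countRange Q x b) (sym (+-identityʳ s))
countRange-+ Q s (suc a) b = trans (cong ([ Q s ] +_) (trans (countRange-+ Q (suc s) a b)
                                     (cong (λ x → countRange Q (suc s) a + countRange Q x b) (sym (+-suc s a)))))
                                   (sym (+-assoc [ Q s ] (countRange Q (suc s) a) (countRange Q (s + suc a) b)))

rank : ∀ {k} → (Fin k → Bool) → Fin k → ℕ
rank p zero    = 0
rank p (suc i) = [ p zero ] + rank (p ∘ suc) i

rowStart : ∀ {m} → (Fin m → ℕ) → Fin m → ℕ
rowStart r zero    = 0
rowStart r (suc u) = r zero + rowStart (r ∘ suc) u

-- The position of the true entry (u, v) of B in the row-major enumeration of all true entries.
index : ∀ {m k} → (Fin m → Fin k → Bool) → Fin m → Fin k → ℕ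
index B u v = rowStart (count ∘ B) u + rank (B u) v

count-rank : ∀ {k} Q s (p : Fin k → Bool) →
  count (λ i → p i ∧ Q (s + rank p i)) ≡ countRange Q s (count p)
count-rank {zero}  Q s p = refl
count-rank {suc k} Q s p with p zero
... | false = count-rank Q s (p ∘ suc)
... | true  rewrite +-identityʳ s =
  cong ([ Q s ] +_) (trans (count-cong (λ i → cong (λ x → p (suc i) ∧ Q x) (+-suc s (rank (p ∘ suc) i))))
                           (count-rank Q (suc s) (p ∘ suc)))

sumFin-count-index : ∀ {m k} Q s (B : Fin m → Fin k → Bool) →
  sumFin (λ u → count (λ v → B u v ∧ Q (s + index B u v))) ≡ countRange Q s (sumFin (count ∘ B))
sumFin-count-index {zero}  Q s B = refl
sumFin-count-index {suc m} Q s B = begin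
  count (λ v → B zero v ∧ Q (s + rank (B zero) v)) + sumFin (λ u → count (λ v → B (suc u) v ∧ Q (s + index B (suc u) v)))
    ≡⟨ cong₂ _+_ (count-rank Q s (B zero)) (trans (sumFin-cong (λ u → count-cong (λ v →
         cong (λ x → B (suc u) v ∧ Q x) (shift u v)))) (sumFin-count-index Q (s + c₀) (B ∘ suc))) ⟩
  countRange Q s c₀ + countRange Q (s + c₀) (sumFin (count ∘ B ∘ suc))
    ≡⟨ sym (countRange-+ Q s c₀ (sumFin (count ∘ B ∘ suc))) ⟩
  countRange Q s (sumFin (count ∘ B)) ∎
  where
  open ≡-Reasoning
  c₀ = count (B zero)
  shift : ∀ u v → s + index B (suc u) v ≡ s + c₀ + index (B ∘ suc) u v
  shift u v = trans (cong (s +_) (+-assoc c₀ _ _)) (sym (+-assoc s c₀ _))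

-- Truncated subtraction keeps the bound meaningful on both sides of the window: it is C
-- before position L and shrinks by one for every position of the window already passed.
countRange-window : ∀ {Q L C T} .{{_ : NonZero C}} →
  (∀ i → i < T → Q i ≡ true → L ≤ i × i < L + C) →
  ∀ s t → s + t ≤ T → countRange Q s t ≤ C ∸ (s ∸ L)
countRange-window window s zero    bound = z≤n
countRange-window {Q} {L} {C} {T} window s (suc t) bound
  with Q s in qs | countRange-window window (suc s) t (subst (_≤ T) (+-suc s t) bound)
... | false | rest = ≤-trans rest (∸-monoʳ-≤ C (∸-monoˡ-≤ L (n≤1+n s)))
... | true  | rest with window s (≤-trans (s≤s (m≤m+n s t)) (subst (_≤ T) (+-suc s t) bound)) qs
... | L≤s , s<L+C = begin
  1 + countRange Q (suc s) t    ≤⟨ +-monoʳ-≤ 1 rest ⟩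
  1 + (C ∸ (1 + s ∸ L))         ≡⟨ cong (λ x → 1 + (C ∸ x)) (+-∸-assoc 1 L≤s) ⟩
  1 + (C ∸ (1 + (s ∸ L)))       ≡⟨ sym (+-∸-assoc 1 (m<n+o⇒m∸n<o s L s<L+C)) ⟩
  C ∸ (s ∸ L)                   ∎
  where open ≤-Reasoning

m<m/n*n+n : ∀ m n .{{_ : NonZero n}} → m < m / n * n + n
m<m/n*n+n m n = begin-strict
  m                  ≡⟨ m≡m%n+[m/n]*n m n ⟩
  m % n + m / n * n  <⟨ +-monoˡ-< (m / n * n) (m%n<n m n) ⟩
  n + m / n * n      ≡⟨ +-comm n (m / n * n) ⟩
  m / n * n + n      ∎
  where open ≤-Reasoning

-- Position i goes to block ⌊i/C⌋; the reduction mod K only makes this a total map into Fin K.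
block : (C K : ℕ) .{{_ : NonZero C}} .{{_ : NonZero K}} → ℕ → Fin K
block C K i = (i / C) mod K

block-window : ∀ C K .{{_ : NonZero C}} .{{_ : NonZero K}} {i l} →
  i < K * C → block C K i ≡ l → toℕ l * C ≤ i × i < toℕ l * C + C
block-window C K {i} i<KC refl rewrite toℕ-fromℕ< (m%n<n (i / C) K) | m<n⇒m%n≡m (m<n*o⇒m/o<n {i} {K} {C} i<KC) =
  m/n*n≤m i C , m<m/n*n+n i C

ceilDiv-spec : ∀ m d .{{_ : NonZero d}} → m ≤ ceilDiv m d * d
ceilDiv-spec m (suc d) = +-cancelʳ-≤ d m (q * suc d) (begin
  m + d                      ≡⟨ m≡m%n+[m/n]*n (m + d) (suc d) ⟩
  (m + d) % suc d + q * suc d ≤⟨ +-monoˡ-≤ (q * suc d) (s≤s⁻¹ (m%n<n (m + d) (suc d))) ⟩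
  d + q * suc d              ≡⟨ +-comm d (q * suc d) ⟩
  q * suc d + d              ∎)
  where
  open ≤-Reasoning
  q = (m + d) / suc d

uniform-feasible : ∀ n C Δ K .{{_ : NonZero C}} .{{_ : NonZero K}} →
  n * Δ ≤ K * (2 * C) → Feasible n C Δ (λ _ → K)
uniform-feasible n C Δ K nΔ≤2KC R maxdeg = K , c , classSize≤ , λ v → count≤ (appearsIn R c v)
  where
  c : Labelling n K
  c u v = block C K (index (isEdge R) u v)

  edgeCount≤KC : edgeCount R ≤ K * C
  edgeCount≤KC = *-cancelˡ-≤ 2 (≤-trans (edgeCount≤ R maxdeg)
                   (≤-trans nΔ≤2KC (≤-reflexive (x∙yz≈y∙xz K 2 C))))

  module _ (l : Fin K) where
    inBlock : ℕ → Bool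
    inBlock i = ⌊ block C K i ≟ l ⌋

    inBlock-window : ∀ i → i < K * C → inBlock i ≡ true → toℕ l * C ≤ i × i < toℕ l * C + C
    inBlock-window i i<KC q with block C K i ≟ l
    ... | yes i∈l = block-window C K i<KC i∈l

    classSize≤ : classSize R c l ≤ C
    classSize≤ = begin
      classSize R c l                     ≡⟨ sumFin-count-index inBlock 0 (isEdge R) ⟩
      countRange inBlock 0 (edgeCount R)  ≤⟨ countRange-window inBlock-window 0 (edgeCount R) edgeCount≤KC ⟩
      C ∸ (0 ∸ toℕ l * C)                 ≡⟨ cong (C ∸_) (0∸n≡0 (toℕ l * C)) ⟩
      C                                   ∎
      where open ≤-Reasoning

lemma4 : (n C Δ : ℕ) → 1 ≤ n → 1 ≤ C → 1 ≤ Δ →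
    Σ (Fin n → ℕ) λ A → Feasible n C Δ A × sumFin A ≤ ceilDiv (n * Δ) (2 * C) * n
lemma4 n C@(suc _) Δ 1≤n _ 1≤Δ with ceilDiv (n * Δ) (2 * C) | ceilDiv-spec (n * Δ) (2 * C)
... | zero  | nΔ≤0 with () ← ≤-trans (*-mono-≤ 1≤n 1≤Δ) nΔ≤0
... | K@(suc _) | nΔ≤K[2C] =
  (λ _ → K) ,
  uniform-feasible n C Δ K nΔ≤K[2C] ,
  ≤-reflexive (trans (sumFin-const n K) (*-comm n K))
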